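{- (1) If $\forall\mathbf{HLJ}+(\forall\text{ - }\mathrm{R_{ms}})+(\exists\text{ - }\mathrm{L_m})$ derives $\Gamma_1\Rightarrow\varphi_1\mid\cdots\mid\Gamma_n\Rightarrow\varphi_n$, then for some $i$ the universal closure of $\bigwedge\Gamma_i\to\varphi_i$ is $\forall\mathbf{INT}$-valid. (2) If $\forall\mathbf{HLJ}'+(\forall\text{ - }\mathrm{R_{ms}})+(\exists\text{ - }\mathrm{L_m})$ derives $\Gamma_1\Rightarrow\Delta_1\mid\cdots\mid\Gamma_n\Rightarrow\Delta_n$, then for some $i$ the universal closure of $\bigwedge\Gamma_i\to\bigvee\Delta_i$ is $\forall\mathbf{INT}$-valid.
   Context: Formulas are first-order formulas built from atoms and $\bot$ with $\land,\lor,\to,\forall,\exists$. A sequent $\Gamma\Rightarrow\Delta$ consists of finite sequences of formulas; a hypersequent is a finite sequence of sequents $\Gamma_1\Rightarrow\Delta_1\mid\cdots\mid\Gamma_n\Rightarrow\Delta_n$; $G,H$ denote possibly empty hypersequents, $S,T$ sequents. An empty conjunction is $\top$, an empty disjunction is $\bot$. $\mathbf{HLK}$ has: axioms $\varphi\Rightarrow\varphi$, $\bot\Rightarrow\varphi$; external weakening (from $G$ infer $S\mid G$), contraction (from $S\mid S\mid G$ infer $S\mid G$), exchange (from $G\mid S\mid T\mid H$ infer $G\mid T\mid S\mid H$); internal weakening, contraction and exchange on either side of a component, with arbitrary side hypersequent $G$; cut: from $\Gamma_0\Rightarrow\Delta_0,\delta\mid G$ and $\delta,\Gamma_1\Rightarrow\Delta_1\mid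 G$ infer $\Gamma_0,\Gamma_1\Rightarrow\Delta_0,\Delta_1\mid G$; logical rules with side hypersequent $G$: from $\varphi_i,\Gamma\Rightarrow\Delta\mid G$ infer $\varphi_1\land\varphi_2,\Gamma\Rightarrow\Delta\mid G$; from $\Gamma\Rightarrow\Delta,\varphi_1\mid G$ and $\Gamma\Rightarrow\Delta,\varphi_2\mid G$ infer $\Gamma\Rightarrow\Delta,\varphi_1\land\varphi_2\mid G$; from $\varphi_1,\Gamma\Rightarrow\Delta\mid G$ and $\varphi_2,\Gamma\Rightarrow\Delta\mid G$ infer $\varphi_1\lor\varphi_2,\Gamma\Rightarrow\Delta\mid G$; from $\Gamma\Rightarrow\Delta,\varphi_i\mid G$ infer $\Gamma\Rightarrow\Delta,\varphi_1\lor\varphi_2\mid G$; from $\Gamma\Rightarrow\Delta,\varphi\mid G$ and $\psi,\Gamma\Rightarrow\Delta\mid G$ infer $\varphi\to\psi,\Gamma\Rightarrow\Delta\mid G$; from $\varphi,\Gamma\Rightarrow\Delta,\psi\mid G$ infer $\Gamma\Rightarrow\Delta,\varphi\to\psi\mid G$. $\mathbf{HLJ}'$ is $\mathbf{HLK}$ with the last rule replaced by: from $\varphi,\Gamma\Rightarrow\psi\mid G$ infer $\Gamma\Rightarrow\varphi\to\psi\mid G$. $\mathbf{HLJ}$ is $\mathbf{HLK}$ restricted to single-conclusion sequents (every succedent has at most one formula). $\forall\mathbf{HLJ}$ (resp. $\forall\mathbf{HLJ}'$) is $\mathbf{HLJ}$ (resp. $\mathbf{HLJ}'$) plus: from $[t/x]\varphi,\Gamma\Rightarrow\Delta\mid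 G$ infer $\forall x\varphi,\Gamma\Rightarrow\Delta\mid G$; from $\Gamma\Rightarrow\varphi$ infer $\Gamma\Rightarrow\forall x\varphi$ (single component, $x$ not free in $\Gamma$); from $\varphi,\Gamma\Rightarrow\Delta$ infer $\exists x\varphi,\Gamma\Rightarrow\Delta$ (single component, $x$ not free in $\Gamma,\Delta$); from $\Gamma\Rightarrow\Delta,[t/x]\psi\mid G$ infer $\Gamma\Rightarrow\Delta,\exists x\psi\mid G$. $(\forall\text{ - }\mathrm{R_{ms}})$: from $\Gamma\Rightarrow\varphi\mid G$ infer $\Gamma\Rightarrow\forall x\varphi\mid G$, provided $x$ is not free in the conclusion. $(\exists\text{ - }\mathrm{L_m})$: from $\varphi,\Gamma\Rightarrow\Delta\mid G$ infer $\exists x\varphi,\Gamma\Rightarrow\Delta\mid G$, with the eigenvariable condition that $x$ is not free in the conclusion. $\forall\mathbf{INT}$ is intuitionistic predicate logic; "valid" means valid (equivalently provable) in it. -}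

module Defs where

open import Data.Nat using (ℕ; suc; _≡ᵇ_; _⊔_; _≤_)
open import Data.Bool using (Bool; true; false; not; if_then_else_)
open import Data.List using (List; []; _∷_; _++_; [_]; map; concatMap; filterᵇ; foldr; length)
open import Data.Bool.ListAction using (any)
open import Data.List.Membership.Propositional using (_∉_)
open import Data.List.Relation.Unary.All using (All)
open import Data.Product using (_×_; _,_; proj₁; proj₂)
open import Data.Unit using (⊤)

data Term : Set where
  var : ℕ → Term
  fun : ℕ → List Term → Term

infixr 6 _∧'_
infixr 5 _∨'_
infixr 4 _⇒'_

data Formula : Set where
  atom : ℕ → List Term → Formula
  ⊥'   : Formula
  _∧'_ _∨'_ _⇒'_ : Formula → Formula → Formula
  ∀' ∃' : ℕ → Formula → Formula

mutual
  fvT : Term → List ℕ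
  fvT (var x)    = x ∷ []
  fvT (fun f ts) = fvTs ts

  fvTs : List Term → List ℕ
  fvTs []       = []
  fvTs (t ∷ ts) = fvT t ++ fvTs ts

fv : Formula → List ℕ
fv (atom p ts) = fvTs ts
fv ⊥'          = []
fv (φ ∧' ψ)    = fv φ ++ fv ψ
fv (φ ∨' ψ)    = fv φ ++ fv ψ
fv (φ ⇒' ψ)    = fv φ ++ fv ψ
fv (∀' x φ)    = filterᵇ (λ y → not (y ≡ᵇ x)) (fv φ)
fv (∃' x φ)    = filterᵇ (λ y → not (y ≡ᵇ x)) (fv φ)

fvs : List Formula → List ℕ
fvs = concatMap fv

Subst : Set
Subst = ℕ → Term

_[_↦_] : Subst → ℕ → Term → Subst
(σ [ y ↦ t ]) w = if w ≡ᵇ y then t else σ w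

mutual
  substT : Subst → Term → Term
  substT σ (var x)    = σ x
  substT σ (fun f ts) = fun f (substTs σ ts)

  substTs : Subst → List Term → List Term
  substTs σ []       = []
  substTs σ (t ∷ ts) = substT σ t ∷ substTs σ ts

maxList : List ℕ → ℕ
maxList = foldr _⊔_ 0

-- the name used for the bound variable y of (Q y φ) when substituting σ:
-- y itself unless it would capture a variable of some σ w, w free in Q y φ;
-- otherwise a variable not occurring in any such σ w.
binder : Subst → ℕ → List ℕ → ℕ
binder σ y ws =
  let cs = concatMap (λ w → fvT (σ w)) ws in
  if any (λ c → c ≡ᵇ y) cs then suc (maxList cs) else y

sub : Subst → Formula → Formula
sub σ (atom p ts) = atom p (substTs σ ts)
sub σ ⊥'          = ⊥'
sub σ (φ ∧' ψ)    = sub σ φ ∧' sub σ ψ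
sub σ (φ ∨' ψ)    = sub σ φ ∨' sub σ ψ
sub σ (φ ⇒' ψ)    = sub σ φ ⇒' sub σ ψ
sub σ (∀' y φ)    = let z = binder σ y (fv (∀' y φ)) in ∀' z (sub (σ [ y ↦ var z ]) φ)
sub σ (∃' y φ)    = let z = binder σ y (fv (∃' y φ)) in ∃' z (sub (σ [ y ↦ var z ]) φ)

_[_/_] : Formula → Term → ℕ → Formula
φ [ t / x ] = sub (var [ x ↦ t ]) φ

⊤' : Formula
⊤' = ⊥' ⇒' ⊥'

⋀ : List Formula → Formula
⋀ []           = ⊤'
⋀ (φ ∷ [])     = φ
⋀ (φ ∷ ψ ∷ Γ)  = φ ∧' ⋀ (ψ ∷ Γ)

⋁ : List Formula → Formula
⋁ []           = ⊥'
⋁ (φ ∷ [])     = φ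
⋁ (φ ∷ ψ ∷ Γ)  = φ ∨' ⋁ (ψ ∷ Γ)

closure : Formula → Formula
closure φ = foldr ∀' φ (fv φ)

-- ∀INT: intuitionistic predicate logic (natural deduction)

infix 3 _⊢_
data _⊢_ : List Formula → Formula → Set where
  hyp  : ∀ {Γ φ} → φ Data.List.Membership.Propositional.∈ Γ → Γ ⊢ φ
  ⊥E   : ∀ {Γ φ} → Γ ⊢ ⊥' → Γ ⊢ φ
  ∧I   : ∀ {Γ φ ψ} → Γ ⊢ φ → Γ ⊢ ψ → Γ ⊢ φ ∧' ψ
  ∧E₁  : ∀ {Γ φ ψ} → Γ ⊢ φ ∧' ψ → Γ ⊢ φ
  ∧E₂  : ∀ {Γ φ ψ} → Γ ⊢ φ ∧' ψ → Γ ⊢ ψ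
  ∨I₁  : ∀ {Γ φ ψ} → Γ ⊢ φ → Γ ⊢ φ ∨' ψ
  ∨I₂  : ∀ {Γ φ ψ} → Γ ⊢ ψ → Γ ⊢ φ ∨' ψ
  ∨E   : ∀ {Γ φ ψ χ} → Γ ⊢ φ ∨' ψ → φ ∷ Γ ⊢ χ → ψ ∷ Γ ⊢ χ → Γ ⊢ χ
  ⇒I   : ∀ {Γ φ ψ} → φ ∷ Γ ⊢ ψ → Γ ⊢ φ ⇒' ψ
  ⇒E   : ∀ {Γ φ ψ} → Γ ⊢ φ ⇒' ψ → Γ ⊢ φ → Γ ⊢ ψ
  ∀I   : ∀ {Γ x φ} → x ∉ fvs Γ → Γ ⊢ φ → Γ ⊢ ∀' x φ
  ∀E   : ∀ {Γ x φ} (t : Term) → Γ ⊢ ∀' x φ → Γ ⊢ φ [ t / x ]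
  ∃I   : ∀ {Γ x φ} (t : Term) → Γ ⊢ φ [ t / x ] → Γ ⊢ ∃' x φ
  ∃E   : ∀ {Γ x φ χ} → x ∉ fvs Γ → x ∉ fv χ →
         Γ ⊢ ∃' x φ → φ ∷ Γ ⊢ χ → Γ ⊢ χ

Valid : Formula → Set
Valid φ = [] ⊢ φ

Sequent : Set
Sequent = List Formula × List Formula

Hyperseq : Set
Hyperseq = List Sequent

fvH : Hyperseq → List ℕ
fvH = concatMap (λ S → fvs (proj₁ S) ++ fvs (proj₂ S))

-- One rule step of the calculus ∀HLJ(') + (∀-R_ms) + (∃-L_m), with
-- premises required to satisfy P.  In every rule the active component is
-- the first one, followed by the side hypersequent G.
data Step (P : Hyperseq → Set) : Hyperseq → Set where
  ax   : ∀ φ → Step P ((φ ∷ [] , φ ∷ []) ∷ [])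
  ⊥ax  : ∀ φ → Step P ((⊥' ∷ [] , φ ∷ []) ∷ [])
  ew   : ∀ {S G} → P G → Step P (S ∷ G)
  ec   : ∀ {S G} → P (S ∷ S ∷ G) → Step P (S ∷ G)
  ee   : ∀ {G S T H} → P (G ++ S ∷ T ∷ H) → Step P (G ++ T ∷ S ∷ H)
  iwL  : ∀ {φ Γ Δ G} → P ((Γ , Δ) ∷ G) → Step P ((φ ∷ Γ , Δ) ∷ G)
  iwR  : ∀ {φ Γ Δ G} → P ((Γ , Δ) ∷ G) → Step P ((Γ , Δ ++ [ φ ]) ∷ G)
  icL  : ∀ {φ Γ Δ G} → P ((φ ∷ φ ∷ Γ , Δ) ∷ G) → Step P ((φ ∷ Γ , Δ) ∷ G)
  icR  : ∀ {φ Γ Δ G} → P ((Γ , Δ ++ φ ∷ φ ∷ []) ∷ G) → Step P ((Γ , Δ ++ [ φ ]) ∷ G)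
  ieL  : ∀ {φ ψ Γ₁ Γ₂ Δ G} → P ((Γ₁ ++ φ ∷ ψ ∷ Γ₂ , Δ) ∷ G) →
         Step P ((Γ₁ ++ ψ ∷ φ ∷ Γ₂ , Δ) ∷ G)
  ieR  : ∀ {φ ψ Γ Δ₁ Δ₂ G} → P ((Γ , Δ₁ ++ φ ∷ ψ ∷ Δ₂) ∷ G) →
         Step P ((Γ , Δ₁ ++ ψ ∷ φ ∷ Δ₂) ∷ G)
  cut  : ∀ {δ Γ₀ Δ₀ Γ₁ Δ₁ G} → P ((Γ₀ , Δ₀ ++ [ δ ]) ∷ G) → P ((δ ∷ Γ₁ , Δ₁) ∷ G) →
         Step P ((Γ₀ ++ Γ₁ , Δ₀ ++ Δ₁) ∷ G)
  ∧L₁  : ∀ {φ₁ φ₂ Γ Δ G} → P ((φ₁ ∷ Γ , Δ) ∷ G) → Step P (((φ₁ ∧' φ₂) ∷ Γ , Δ) ∷ G)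
  ∧L₂  : ∀ {φ₁ φ₂ Γ Δ G} → P ((φ₂ ∷ Γ , Δ) ∷ G) → Step P (((φ₁ ∧' φ₂) ∷ Γ , Δ) ∷ G)
  ∧R   : ∀ {φ₁ φ₂ Γ Δ G} → P ((Γ , Δ ++ [ φ₁ ]) ∷ G) → P ((Γ , Δ ++ [ φ₂ ]) ∷ G) →
         Step P ((Γ , Δ ++ [ φ₁ ∧' φ₂ ]) ∷ G)
  ∨L   : ∀ {φ₁ φ₂ Γ Δ G} → P ((φ₁ ∷ Γ , Δ) ∷ G) → P ((φ₂ ∷ Γ , Δ) ∷ G) →
         Step P (((φ₁ ∨' φ₂) ∷ Γ , Δ) ∷ G)
  ∨R₁  : ∀ {φ₁ φ₂ Γ Δ G} → P ((Γ , Δ ++ [ φ₁ ]) ∷ G) → Step P ((Γ , Δ ++ [ φ₁ ∨' φ₂ ]) ∷ G)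
  ∨R₂  : ∀ {φ₁ φ₂ Γ Δ G} → P ((Γ , Δ ++ [ φ₂ ]) ∷ G) → Step P ((Γ , Δ ++ [ φ₁ ∨' φ₂ ]) ∷ G)
  ⇒L   : ∀ {φ ψ Γ Δ G} → P ((Γ , Δ ++ [ φ ]) ∷ G) → P ((ψ ∷ Γ , Δ) ∷ G) →
         Step P (((φ ⇒' ψ) ∷ Γ , Δ) ∷ G)
  -- intuitionistic implication right (rule of HLJ'; in HLJ the HLK rule
  -- restricted to single conclusions is exactly this rule)
  ⇒R   : ∀ {φ ψ Γ G} → P ((φ ∷ Γ , ψ ∷ []) ∷ G) → Step P ((Γ , (φ ⇒' ψ) ∷ []) ∷ G)
  ∀L   : ∀ {x φ Γ Δ G} (t : Term) → P ((φ [ t / x ] ∷ Γ , Δ) ∷ G) →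
         Step P ((∀' x φ ∷ Γ , Δ) ∷ G)
  ∀R   : ∀ {x φ Γ} → x ∉ fvs Γ → P ((Γ , φ ∷ []) ∷ []) →
         Step P ((Γ , ∀' x φ ∷ []) ∷ [])
  ∃L   : ∀ {x φ Γ Δ} → x ∉ fvs Γ → x ∉ fvs Δ → P ((φ ∷ Γ , Δ) ∷ []) →
         Step P ((∃' x φ ∷ Γ , Δ) ∷ [])
  ∃R   : ∀ {x ψ Γ Δ G} (t : Term) → P ((Γ , Δ ++ [ ψ [ t / x ] ]) ∷ G) →
         Step P ((Γ , Δ ++ [ ∃' x ψ ]) ∷ G)
  ∀Rms : ∀ {x φ Γ G} → x ∉ fvH ((Γ , ∀' x φ ∷ []) ∷ G) → P ((Γ , φ ∷ []) ∷ G) →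
         Step P ((Γ , ∀' x φ ∷ []) ∷ G)
  ∃Lm  : ∀ {x φ Γ Δ G} → x ∉ fvH ((∃' x φ ∷ Γ , Δ) ∷ G) → P ((φ ∷ Γ , Δ) ∷ G) →
         Step P ((∃' x φ ∷ Γ , Δ) ∷ G)

data Sys : Set where
  J  : Sys
  J' : Sys

-- HLJ: every hypersequent occurring in a derivation is single-conclusion
Ok : Sys → Hyperseq → Set
Ok J  H = All (λ S → length (proj₂ S) ≤ 1) H
Ok J' H = ⊤

data Der (s : Sys) : Hyperseq → Set where
  node : ∀ {H} → Ok s H → Step (Der s) H → Der s H

-- Read a component Γ ⇒ Δ as the formula ⋀Γ → ⋁Δ and a hypersequent as the
-- (meta-level) disjunction of its components.  Every rule preserves "some
-- component is intuitionistically valid": in a rule with side hypersequent G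
-- either the valid component already lies in G, which is passed on unchanged,
-- or it is the active one, and then the rule is an intuitionistic inference
-- on ⋀Γ → ⋁Δ.  The only delicate rules are (∀-R_ms) and (∃-L_m), which act
-- on a component of a hypersequent; their eigenvariable condition, imposed on
-- the whole conclusion, in particular keeps x out of the active component, so
-- the usual quantifier shifts apply to it.  Validity is closed under
-- universal closure.
module Submission where

open import Defs
open import Data.Bool using (true; false; not; T; T?)
open import Data.Bool.ListAction using (any)
open import Data.Empty using (⊥)
open import Data.List using (List; []; _∷_; _++_; [_]; map; concatMap; filterᵇ; foldr)
open import Data.List.Membership.Propositional using (_∈_; _∉_)
open import Data.List.Membership.Propositional.Properties
  using (∈-++⁺ˡ; ∈-++⁺ʳ; ∈-++⁻; ∈-filter⁻)
open import Data.List.Relation.Binary.Permutation.Propositional using (_↭_; swap; ↭-refl)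
import Data.List.Relation.Binary.Permutation.Propositional.Properties as ↭
open import Data.List.Relation.Binary.Subset.Propositional using (_⊆_)
open import Data.List.Relation.Binary.Subset.Propositional.Properties
  using (⊆-refl; ⊆-reflexive-↭; Any-resp-⊆; xs⊆x∷xs; xs⊆xs++ys; xs⊆ys++xs; ∈-∷⁺ʳ; ++⁺ʳ)
open import Data.List.Relation.Unary.Any using (Any; here; there)
import Data.List.Relation.Unary.Any as Any
import Data.List.Relation.Unary.Any.Properties as Any
open import Data.Nat using (ℕ; _≡ᵇ_)
open import Data.Nat.Properties using (≡ᵇ⇒≡; ≡⇒≡ᵇ)
open import Data.Product using (_×_; _,_; proj₁; proj₂)
open import Data.Sum using ([_,_]′)
open import Function using (_∘_)
open import Relation.Binary.PropositionalEquality using (_≡_; refl; sym; cong; cong₂; subst)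

variable
  x : ℕ
  a b c d g p q r φ φ′ δ : Formula
  Γ Γ′ Δ Δ′ : List Formula

IdSubst : Subst → Set
IdSubst σ = ∀ w → σ w ≡ var w

mutual
  substT-id : ∀ {σ} → IdSubst σ → ∀ t → substT σ t ≡ t
  substT-id σ-id (var w)    = σ-id w
  substT-id σ-id (fun f ts) = cong (fun f) (substTs-id σ-id ts)

  substTs-id : ∀ {σ} → IdSubst σ → ∀ ts → substTs σ ts ≡ ts
  substTs-id σ-id []       = refl
  substTs-id σ-id (t ∷ ts) = cong₂ _∷_ (substT-id σ-id t) (substTs-id σ-id ts)

-- Under an identity substitution the only variable of σ w is w, and w ranges
-- over free variables other than the binder y, so y is never captured.
binder-no-capture : ∀ {σ} → IdSubst σ → ∀ y l →
  any (λ c → c ≡ᵇ y) (concatMap (λ w → fvT (σ w)) (filterᵇ (λ v → not (v ≡ᵇ y)) l)) ≡ false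
binder-no-capture σ-id y []      = refl
binder-no-capture σ-id y (w ∷ l) with w ≡ᵇ y in w≡ᵇy
... | true  = binder-no-capture σ-id y l
... | false rewrite σ-id w | w≡ᵇy = binder-no-capture σ-id y l

binder-id : ∀ {σ} → IdSubst σ → ∀ y l → binder σ y (filterᵇ (λ v → not (v ≡ᵇ y)) l) ≡ y
binder-id σ-id y l rewrite binder-no-capture σ-id y l = refl

[↦var]-id : ∀ {σ} → IdSubst σ → ∀ y → IdSubst (σ [ y ↦ var y ])
[↦var]-id σ-id y w with w ≡ᵇ y in w≡ᵇy
... | true  = cong var (sym (≡ᵇ⇒≡ w y (subst T (sym w≡ᵇy) _)))
... | false = σ-id w

sub-id : ∀ {σ} → IdSubst σ → ∀ φ → sub σ φ ≡ φ
sub-id σ-id (atom P ts) = cong (atom P) (substTs-id σ-id ts)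
sub-id σ-id ⊥'          = refl
sub-id σ-id (φ ∧' ψ)    = cong₂ _∧'_ (sub-id σ-id φ) (sub-id σ-id ψ)
sub-id σ-id (φ ∨' ψ)    = cong₂ _∨'_ (sub-id σ-id φ) (sub-id σ-id ψ)
sub-id σ-id (φ ⇒' ψ)    = cong₂ _⇒'_ (sub-id σ-id φ) (sub-id σ-id ψ)
sub-id σ-id (∀' y φ) rewrite binder-id σ-id y (fv φ) = cong (∀' y) (sub-id ([↦var]-id σ-id y) φ)
sub-id σ-id (∃' y φ) rewrite binder-id σ-id y (fv φ) = cong (∃' y) (sub-id ([↦var]-id σ-id y) φ)

[var/]-id : ∀ φ x → φ [ var x / x ] ≡ φ
[var/]-id φ x = sub-id ([↦var]-id {var} (λ _ → refl) x) φ

∉-++⁺ : ∀ {xs ys : List ℕ} → x ∉ xs → x ∉ ys → x ∉ xs ++ ys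
∉-++⁺ {xs = xs} x∉xs x∉ys x∈ = [ x∉xs , x∉ys ]′ (∈-++⁻ xs x∈)

∉-remove : ∀ x l → x ∉ filterᵇ (λ y → not (y ≡ᵇ x)) l
∉-remove x l x∈ = T-not-T (≡⇒≡ᵇ x x refl) (proj₂ (∈-filter⁻ (λ y → T? (not (y ≡ᵇ x))) {xs = l} x∈))
  where
  T-not-T : ∀ {b} → T b → T (not b) → ⊥
  T-not-T {true} _ ()

∉-fv-∀' : x ∉ fv (∀' x φ)
∉-fv-∀' {x} {φ} = ∉-remove x (fv φ)

∉-fv-∃' : x ∉ fv (∃' x φ)
∉-fv-∃' {x} {φ} = ∉-remove x (fv φ)

fv-⋀ : ∀ Γ → fv (⋀ Γ) ⊆ fvs Γ
fv-⋀ (φ ∷ [])     x∈ = ∈-++⁺ˡ x∈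
fv-⋀ (φ ∷ ψ ∷ Γ)  x∈ = [ ∈-++⁺ˡ , ∈-++⁺ʳ (fv φ) ∘ fv-⋀ (ψ ∷ Γ) ]′ (∈-++⁻ (fv φ) x∈)

fv-⋁ : ∀ Δ → fv (⋁ Δ) ⊆ fvs Δ
fv-⋁ (φ ∷ [])     x∈ = ∈-++⁺ˡ x∈
fv-⋁ (φ ∷ ψ ∷ Δ)  x∈ = [ ∈-++⁺ˡ , ∈-++⁺ʳ (fv φ) ∘ fv-⋁ (ψ ∷ Δ) ]′ (∈-++⁻ (fv φ) x∈)

∉-fvH-head : ∀ Γ Δ G → x ∉ fvH ((Γ , Δ) ∷ G) → x ∉ fvs Γ × x ∉ fvs Δ
∉-fvH-head Γ Δ G x∉ = x∉ ∘ ∈-++⁺ˡ ∘ ∈-++⁺ˡ , x∉ ∘ ∈-++⁺ˡ ∘ ∈-++⁺ʳ (fvs Γ)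

infix  2 _⊩_
infixr 9 _⨾_

_⊩_ : Formula → Formula → Set
a ⊩ b = [] ⊢ a ⇒' b

pattern #0 = hyp (here refl)
pattern #1 = hyp (there (here refl))
pattern #2 = hyp (there (there (here refl)))
pattern #3 = hyp (there (there (there (here refl))))

-- ⊢ is not closed under weakening of the context (∀I and ∃E constrain its
-- free variables), so each rule about ⊩ is proved by deriving the
-- corresponding tautology in the empty context and applying modus ponens.
⇒E₂ : [] ⊢ p ⇒' q ⇒' r → [] ⊢ p → [] ⊢ q → [] ⊢ r
⇒E₂ t u v = ⇒E (⇒E t u) v

⊩-refl : a ⊩ a
⊩-refl = ⇒I #0

_⨾_ : a ⊩ b → b ⊩ c → a ⊩ c
_⨾_ = ⇒E₂ (⇒I (⇒I (⇒I (⇒E #1 (⇒E #2 #0)))))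

⊥-⊩ : ⊥' ⊩ a
⊥-⊩ = ⇒I (⊥E #0)

⊩-⊤ : a ⊩ ⊤'
⊩-⊤ = ⇒I (⇒I #0)

∧-proj₁ : a ∧' b ⊩ a
∧-proj₁ = ⇒I (∧E₁ #0)

∧-proj₂ : a ∧' b ⊩ b
∧-proj₂ = ⇒I (∧E₂ #0)

∧-pair : a ⊩ b → a ⊩ c → a ⊩ b ∧' c
∧-pair = ⇒E₂ (⇒I (⇒I (⇒I (∧I (⇒E #2 #0) (⇒E #1 #0)))))

∨-inj₁ : a ⊩ a ∨' b
∨-inj₁ = ⇒I (∨I₁ #0)

∨-inj₂ : b ⊩ a ∨' b
∨-inj₂ = ⇒I (∨I₂ #0)

∨-case : b ⊩ a → c ⊩ a → b ∨' c ⊩ a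
∨-case = ⇒E₂ (⇒I (⇒I (⇒I (∨E #0 (⇒E #3 #0) (⇒E #2 #0)))))

⋀-proj : φ ∈ Γ → ⋀ Γ ⊩ φ
⋀-proj {Γ = φ ∷ []}    (here refl) = ⊩-refl
⋀-proj {Γ = φ ∷ ψ ∷ Γ} (here refl) = ∧-proj₁
⋀-proj {Γ = φ ∷ ψ ∷ Γ} (there φ∈) = ∧-proj₂ ⨾ ⋀-proj φ∈

⋀-intro : ∀ Γ → (∀ {φ} → φ ∈ Γ → a ⊩ φ) → a ⊩ ⋀ Γ
⋀-intro []          f = ⊩-⊤
⋀-intro (φ ∷ [])    f = f (here refl)
⋀-intro (φ ∷ ψ ∷ Γ) f = ∧-pair (f (here refl)) (⋀-intro (ψ ∷ Γ) (f ∘ there))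

⋁-inj : φ ∈ Δ → φ ⊩ ⋁ Δ
⋁-inj {Δ = φ ∷ []}    (here refl) = ⊩-refl
⋁-inj {Δ = φ ∷ ψ ∷ Δ} (here refl) = ∨-inj₁
⋁-inj {Δ = φ ∷ ψ ∷ Δ} (there φ∈) = ⋁-inj φ∈ ⨾ ∨-inj₂

⋁-elim : ∀ Δ → (∀ {φ} → φ ∈ Δ → φ ⊩ a) → ⋁ Δ ⊩ a
⋁-elim []          f = ⊥-⊩
⋁-elim (φ ∷ [])    f = f (here refl)
⋁-elim (φ ∷ ψ ∷ Δ) f = ∨-case (f (here refl)) (⋁-elim (ψ ∷ Δ) (f ∘ there))

⋀-antimono : ∀ Γ Γ′ → Γ ⊆ Γ′ → ⋀ Γ′ ⊩ ⋀ Γ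
⋀-antimono Γ Γ′ Γ⊆Γ′ = ⋀-intro Γ (⋀-proj ∘ Γ⊆Γ′)

⋁-mono : ∀ Δ Δ′ → Δ ⊆ Δ′ → ⋁ Δ ⊩ ⋁ Δ′
⋁-mono Δ Δ′ Δ⊆Δ′ = ⋁-elim Δ (⋁-inj ∘ Δ⊆Δ′)

⋀-∷ : ∀ φ Γ → ⋀ (φ ∷ Γ) ⊩ φ ∧' ⋀ Γ
⋀-∷ φ Γ = ∧-pair (⋀-proj {Γ = φ ∷ Γ} (here refl)) (⋀-antimono Γ (φ ∷ Γ) there)

⋀-∷⁻ : ∀ φ Γ → φ ∧' ⋀ Γ ⊩ ⋀ (φ ∷ Γ)
⋀-∷⁻ φ Γ = ⋀-intro (φ ∷ Γ) λ { (here refl) → ∧-proj₁ ; (there φ∈) → ∧-proj₂ ⨾ ⋀-proj φ∈ }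

⋁-∷ʳ : ∀ Δ φ → ⋁ (Δ ++ [ φ ]) ⊩ ⋁ Δ ∨' φ
⋁-∷ʳ Δ φ = ⋁-elim (Δ ++ [ φ ]) λ ψ∈ →
  [ (λ ψ∈Δ → ⋁-inj ψ∈Δ ⨾ ∨-inj₁) , (λ { (here refl) → ∨-inj₂ }) ]′ (∈-++⁻ Δ ψ∈)

⋁-∷ʳ⁻ : ∀ Δ φ → ⋁ Δ ∨' φ ⊩ ⋁ (Δ ++ [ φ ])
⋁-∷ʳ⁻ Δ φ = ∨-case (⋁-mono Δ (Δ ++ [ φ ]) (xs⊆xs++ys Δ [ φ ])) (⋁-inj (∈-++⁺ʳ Δ (here refl)))

⋀-map-head : ∀ Γ → φ′ ⊩ φ → ⋀ (φ′ ∷ Γ) ⊩ ⋀ (φ ∷ Γ)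
⋀-map-head Γ φ′⊩φ = ⋀-∷ _ Γ ⨾ ∧-pair (∧-proj₁ ⨾ φ′⊩φ) ∧-proj₂ ⨾ ⋀-∷⁻ _ Γ

⋁-map-last : ∀ Δ → φ′ ⊩ φ → ⋁ (Δ ++ [ φ′ ]) ⊩ ⋁ (Δ ++ [ φ ])
⋁-map-last Δ φ′⊩φ = ⋁-∷ʳ Δ _ ⨾ ∨-case ∨-inj₁ (φ′⊩φ ⨾ ∨-inj₂) ⨾ ⋁-∷ʳ⁻ Δ _

∀E-var : ∀ {Γ} → Γ ⊢ ∀' x φ → Γ ⊢ φ
∀E-var {x} {φ} {Γ} ⊢∀ = subst (Γ ⊢_) ([var/]-id φ x) (∀E (var x) ⊢∀)

∀-shift : x ∉ fv g → [] ⊢ ∀' x (g ⇒' φ) ⇒' g ⇒' ∀' x φ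
∀-shift {x} {g} {φ} x∉g = ⇒I (⇒I (∀I fresh (⇒E (∀E-var #1) #0)))
  where
  fresh : x ∉ fvs (g ∷ ∀' x (g ⇒' φ) ∷ [])
  fresh = ∉-++⁺ x∉g (∉-++⁺ (∉-fv-∀' {φ = g ⇒' φ}) λ ())

∃-shift : x ∉ fv g → x ∉ fv d → [] ⊢ ∀' x (φ ∧' g ⇒' d) ⇒' ∃' x φ ∧' g ⇒' d
∃-shift {x} {g} {d} {φ} x∉g x∉d =
  ⇒I (⇒I (∃E fresh x∉d (∧E₁ #0) (⇒E (∀E-var #2) (∧I #0 (∧E₂ #1)))))
  where
  fresh : x ∉ fvs (∃' x φ ∧' g ∷ ∀' x (φ ∧' g ⇒' d) ∷ [])
  fresh = ∉-++⁺ (∉-++⁺ (∉-fv-∃' {φ = φ}) x∉g) (∉-++⁺ (∉-fv-∀' {φ = φ ∧' g ⇒' d}) λ ())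

cut-⊩ : a ⊩ p ∨' δ → δ ∧' b ⊩ q → a ∧' b ⊩ p ∨' q
cut-⊩ = ⇒E₂ (⇒I (⇒I (⇒I (∨E (⇒E #2 (∧E₁ #0)) (∨I₁ #0) (∨I₂ (⇒E #2 (∧I #0 (∧E₂ #1))))))))

∧R-⊩ : g ⊩ d ∨' a → g ⊩ d ∨' b → g ⊩ d ∨' (a ∧' b)
∧R-⊩ = ⇒E₂ (⇒I (⇒I (⇒I (∨E (⇒E #2 #0) (∨I₁ #0)
                      (∨E (⇒E #2 #1) (∨I₁ #0) (∨I₂ (∧I #1 #0)))))))

∨L-⊩ : a ∧' g ⊩ d → b ∧' g ⊩ d → (a ∨' b) ∧' g ⊩ d
∨L-⊩ = ⇒E₂ (⇒I (⇒I (⇒I (∨E (∧E₁ #0) (⇒E #3 (∧I #0 (∧E₂ #1))) (⇒E #2 (∧I #0 (∧E₂ #1)))))))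

⇒L-⊩ : g ⊩ d ∨' a → b ∧' g ⊩ d → (a ⇒' b) ∧' g ⊩ d
⇒L-⊩ = ⇒E₂ (⇒I (⇒I (⇒I (∨E (⇒E #2 (∧E₂ #0)) #0 (⇒E #2 (∧I (⇒E (∧E₁ #1) #0) (∧E₂ #1)))))))

⇒R-⊩ : a ∧' g ⊩ b → g ⊩ a ⇒' b
⇒R-⊩ = ⇒E (⇒I (⇒I (⇒I (⇒E #2 (∧I #0 #1)))))

∀R-⊩ : x ∉ fv g → g ⊩ φ → g ⊩ ∀' x φ
∀R-⊩ x∉g g⊩φ = ⇒E (∀-shift x∉g) (∀I (λ ()) g⊩φ)

∃L-⊩ : x ∉ fv g → x ∉ fv d → φ ∧' g ⊩ d → ∃' x φ ∧' g ⊩ d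
∃L-⊩ x∉g x∉d φ∧g⊩d = ⇒E (∃-shift x∉g x∉d) (∀I (λ ()) φ∧g⊩d)

Holds : Sequent → Set
Holds S = ⋀ (proj₁ S) ⊩ ⋁ (proj₂ S)

Holds-⊆ : Γ ⊆ Γ′ → Δ ⊆ Δ′ → Holds (Γ , Δ) → Holds (Γ′ , Δ′)
Holds-⊆ {Γ = Γ} {Γ′ = Γ′} {Δ = Δ} {Δ′ = Δ′} Γ⊆Γ′ Δ⊆Δ′ h =
  ⋀-antimono Γ Γ′ Γ⊆Γ′ ⨾ h ⨾ ⋁-mono Δ Δ′ Δ⊆Δ′

Holds-left : ∀ Γ Δ → φ′ ⊩ φ → Holds (φ ∷ Γ , Δ) → Holds (φ′ ∷ Γ , Δ)
Holds-left Γ Δ φ′⊩φ h = ⋀-map-head Γ φ′⊩φ ⨾ h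

Holds-right : ∀ Γ Δ → φ′ ⊩ φ → Holds (Γ , Δ ++ [ φ′ ]) → Holds (Γ , Δ ++ [ φ ])
Holds-right Γ Δ φ′⊩φ h = h ⨾ ⋁-map-last Δ φ′⊩φ

Holds-cut : ∀ Γ₀ Γ₁ Δ₀ Δ₁ →
  Holds (Γ₀ , Δ₀ ++ [ δ ]) → Holds (δ ∷ Γ₁ , Δ₁) → Holds (Γ₀ ++ Γ₁ , Δ₀ ++ Δ₁)
Holds-cut Γ₀ Γ₁ Δ₀ Δ₁ h₀ h₁ =
  ∧-pair (⋀-antimono Γ₀ _ (xs⊆xs++ys Γ₀ Γ₁)) (⋀-antimono Γ₁ _ (xs⊆ys++xs Γ₁ Γ₀))
  ⨾ cut-⊩ (h₀ ⨾ ⋁-∷ʳ Δ₀ _) (⋀-∷⁻ _ Γ₁ ⨾ h₁)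
  ⨾ ∨-case (⋁-mono Δ₀ _ (xs⊆xs++ys Δ₀ Δ₁)) (⋁-mono Δ₁ _ (xs⊆ys++xs Δ₁ Δ₀))

Holds-∧R : ∀ Γ Δ → Holds (Γ , Δ ++ [ a ]) → Holds (Γ , Δ ++ [ b ]) → Holds (Γ , Δ ++ [ a ∧' b ])
Holds-∧R {a} {b} Γ Δ h₁ h₂ = ∧R-⊩ (h₁ ⨾ ⋁-∷ʳ Δ a) (h₂ ⨾ ⋁-∷ʳ Δ b) ⨾ ⋁-∷ʳ⁻ Δ _

Holds-∨L : ∀ Γ Δ → Holds (a ∷ Γ , Δ) → Holds (b ∷ Γ , Δ) → Holds ((a ∨' b) ∷ Γ , Δ)
Holds-∨L {a} {b} Γ Δ h₁ h₂ = ⋀-∷ _ Γ ⨾ ∨L-⊩ (⋀-∷⁻ a Γ ⨾ h₁) (⋀-∷⁻ b Γ ⨾ h₂)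

Holds-⇒L : ∀ Γ Δ → Holds (Γ , Δ ++ [ a ]) → Holds (b ∷ Γ , Δ) → Holds ((a ⇒' b) ∷ Γ , Δ)
Holds-⇒L {a} {b} Γ Δ h₁ h₂ = ⋀-∷ _ Γ ⨾ ⇒L-⊩ (h₁ ⨾ ⋁-∷ʳ Δ a) (⋀-∷⁻ b Γ ⨾ h₂)

Holds-⇒R : ∀ Γ → Holds (a ∷ Γ , [ b ]) → Holds (Γ , [ a ⇒' b ])
Holds-⇒R {a} Γ h = ⇒R-⊩ (⋀-∷⁻ a Γ ⨾ h)

Holds-∀R : ∀ Γ → x ∉ fvs Γ → Holds (Γ , [ φ ]) → Holds (Γ , [ ∀' x φ ])
Holds-∀R Γ x∉Γ h = ∀R-⊩ (x∉Γ ∘ fv-⋀ Γ) h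

Holds-∃L : ∀ Γ Δ → x ∉ fvs Γ → x ∉ fvs Δ → Holds (φ ∷ Γ , Δ) → Holds (∃' x φ ∷ Γ , Δ)
Holds-∃L {φ = φ} Γ Δ x∉Γ x∉Δ h = ⋀-∷ _ Γ ⨾ ∃L-⊩ (x∉Γ ∘ fv-⋀ Γ) (x∉Δ ∘ fv-⋁ Δ) (⋀-∷⁻ φ Γ ⨾ h)

onHead : ∀ {A : Set} {P : A → Set} {S T G} → (P S → P T) → Any P (S ∷ G) → Any P (T ∷ G)
onHead f (here p)  = here (f p)
onHead f (there p) = there p

onHead₂ : ∀ {A : Set} {P : A → Set} {S T U G} →
  (P S → P T → P U) → Any P (S ∷ G) → Any P (T ∷ G) → Any P (U ∷ G)
onHead₂ f (here p)  (here q)  = here (f p q)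
onHead₂ f (there p) _         = there p
onHead₂ f (here _)  (there q) = there q

swap-after : ∀ {A : Set} (xs : List A) u v ys → xs ++ u ∷ v ∷ ys ↭ xs ++ v ∷ u ∷ ys
swap-after xs u v ys = ↭.++⁺ˡ xs (swap u v ↭-refl)

contract-head : ∀ {A : Set} (u : A) xs → u ∷ u ∷ xs ⊆ u ∷ xs
contract-head u xs = ∈-∷⁺ʳ (here refl) ⊆-refl

sound : ∀ {s H} → Der s H → Any Holds H
sound (node _ (ax φ))  = here ⊩-refl
sound (node _ (⊥ax φ)) = here ⊥-⊩
sound (node _ (ew p))  = there (sound p)
sound (node _ (ec {S} {G} p)) = Any-resp-⊆ (contract-head S G) (sound p)
sound (node _ (ee {G} {S} {T} {H} p)) = ↭.Any-resp-↭ (swap-after G S T H) (sound p)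
sound (node _ (iwL {φ} {Γ} {Δ} p)) = onHead (Holds-⊆ {Δ = Δ} (xs⊆x∷xs Γ φ) ⊆-refl) (sound p)
sound (node _ (iwR {φ} {Γ} {Δ} p)) = onHead (Holds-⊆ {Γ = Γ} ⊆-refl (xs⊆xs++ys Δ [ φ ])) (sound p)
sound (node _ (icL {φ} {Γ} {Δ} p)) = onHead (Holds-⊆ {Δ = Δ} (contract-head φ Γ) ⊆-refl) (sound p)
sound (node _ (icR {φ} {Γ} {Δ} p)) = onHead (Holds-⊆ {Γ = Γ} ⊆-refl (++⁺ʳ Δ (contract-head φ []))) (sound p)
sound (node _ (ieL {φ} {ψ} {Γ₁} {Γ₂} {Δ} p)) =
  onHead (Holds-⊆ {Δ = Δ} (⊆-reflexive-↭ (swap-after Γ₁ φ ψ Γ₂)) ⊆-refl) (sound p)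
sound (node _ (ieR {φ} {ψ} {Γ} {Δ₁} {Δ₂} p)) =
  onHead (Holds-⊆ {Γ = Γ} ⊆-refl (⊆-reflexive-↭ (swap-after Δ₁ φ ψ Δ₂))) (sound p)
sound (node _ (cut {Γ₀ = Γ₀} {Δ₀} {Γ₁} {Δ₁} p q)) = onHead₂ (Holds-cut Γ₀ Γ₁ Δ₀ Δ₁) (sound p) (sound q)
sound (node _ (∧L₁ {Γ = Γ} {Δ} p)) = onHead (Holds-left Γ Δ ∧-proj₁) (sound p)
sound (node _ (∧L₂ {Γ = Γ} {Δ} p)) = onHead (Holds-left Γ Δ ∧-proj₂) (sound p)
sound (node _ (∧R {Γ = Γ} {Δ} p q)) = onHead₂ (Holds-∧R Γ Δ) (sound p) (sound q)
sound (node _ (∨L {Γ = Γ} {Δ} p q)) = onHead₂ (Holds-∨L Γ Δ) (sound p) (sound q)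
sound (node _ (∨R₁ {Γ = Γ} {Δ} p)) = onHead (Holds-right Γ Δ ∨-inj₁) (sound p)
sound (node _ (∨R₂ {Γ = Γ} {Δ} p)) = onHead (Holds-right Γ Δ ∨-inj₂) (sound p)
sound (node _ (⇒L {Γ = Γ} {Δ} p q)) = onHead₂ (Holds-⇒L Γ Δ) (sound p) (sound q)
sound (node _ (⇒R {Γ = Γ} p)) = onHead (Holds-⇒R Γ) (sound p)
sound (node _ (∀L {Γ = Γ} {Δ} t p)) = onHead (Holds-left Γ Δ (⇒I (∀E t #0))) (sound p)
sound (node _ (∀R {Γ = Γ} x∉Γ p)) = onHead (Holds-∀R Γ x∉Γ) (sound p)
sound (node _ (∃L {Γ = Γ} {Δ} x∉Γ x∉Δ p)) = onHead (Holds-∃L Γ Δ x∉Γ x∉Δ) (sound p)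
sound (node _ (∃R {Γ = Γ} {Δ} t p)) = onHead (Holds-right Γ Δ (⇒I (∃I t #0))) (sound p)
sound (node _ (∀Rms {x} {φ} {Γ} {G} x∉ p)) =
  onHead (Holds-∀R Γ (proj₁ (∉-fvH-head Γ [ ∀' x φ ] G x∉))) (sound p)
sound (node _ (∃Lm {x} {φ} {Γ} {Δ} {G} x∉ p)) =
  let x∉∃φ∷Γ , x∉Δ = ∉-fvH-head (∃' x φ ∷ Γ) Δ G x∉
  in  onHead (Holds-∃L Γ Δ (x∉∃φ∷Γ ∘ ∈-++⁺ʳ (fv (∃' x φ))) x∉Δ) (sound p)

closure-valid : Valid φ → Valid (closure φ)
closure-valid {φ} ⊢φ = generalize (fv φ)
  where
  generalize : ∀ xs → Valid (foldr ∀' φ xs)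
  generalize []       = ⊢φ
  generalize (x ∷ xs) = ∀I (λ ()) (generalize xs)

mainTheorem9 :
  ((H : List (List Formula × Formula)) →
     Der J (map (λ S → (proj₁ S , proj₂ S ∷ [])) H) →
     Any (λ S → Valid (closure (⋀ (proj₁ S) ⇒' proj₂ S))) H)
  ×
  ((H : Hyperseq) →
     Der J' H →
     Any (λ S → Valid (closure (⋀ (proj₁ S) ⇒' ⋁ (proj₂ S)))) H)
mainTheorem9 =
    (λ H ⊢H → Any.map closure-valid (Any.map⁻ (sound ⊢H)))
  , (λ H ⊢H → Any.map closure-valid (sound ⊢H))
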